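{- Let $k \geq 1$ be an integer, $n$ an odd positive integer, and $p = 2^k n + 1$ a prime. Then there is a polynomial $f_k(x) \in \mathbf{F}_p[x]$ which is a polynomial representation of the square root function modulo $p$ (i.e. $f_k(x)^2 \equiv x \pmod p$ for every quadratic residue $x$ modulo $p$), of degree $\deg(f_k) = 2^{k-1}n - (n-1)/2$, with $2^{k-1}$ terms, and of the form $$f_k(x) = 2^{ -(k-1)} x^{(n+1)/2}\left[c_{2^{k-1}-1} x^{(2^{k-1}-1)n} + c_{2^{k-1}-2} x^{(2^{k-1}-2)n} + \dots + c_2 x^{2n} + c_1 x^n + c_0\right]$$ for some coefficients $c_0, \dots, c_{2^{k-1}-1} \in \mathbf{F}_p$.
   Context: A polynomial $f(x) \in \mathbf{F}_p[x]$ is called a polynomial representation of the square root function mod $p$ if $\sqrt{x} \equiv \pm f(x) \pmod p$, i.e. $f(x)^2 \equiv x \pmod p$, whenever $x$ is a (nonzero) quadratic residue modulo $p$. The number of terms of a polynomial is its number of nonzero monomials. -}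

module Defs where

open import Data.Nat using (ℕ; zero; suc; _+_; _*_; _∸_; _^_; _<_; _%_; _/_)
open import Data.List using (List; []; _∷_; replicate; _++_; length; filter; map)
open import Data.Vec using (Vec; toList)
open import Data.Product using (Σ; _×_)
open import Relation.Binary.PropositionalEquality using (_≡_; _≢_)
open import Relation.Nullary using (¬_)
open import Data.Nat using (_≟_)
open import Relation.Nullary.Decidable using (¬?)

-- reduction modulo p (p is prime in the theorem, so p ≠ 0; the zero
-- clause only makes the function total)
_mod_ : ℕ → ℕ → ℕ
a mod zero    = a
a mod (suc q) = a % suc q

-- Elements of F_p are represented by natural numbers, equality in F_p being
-- congruence modulo p (a mod p ≡ b mod p).

-- A polynomial over F_p is represented densely by its list of coefficients:
-- the i-th entry of the list is the coefficient of x^i.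
Poly : Set
Poly = List ℕ

coeff : Poly → ℕ → ℕ
coeff []       _       = 0
coeff (a ∷ f)  zero    = a
coeff (a ∷ f)  (suc j) = coeff f j

evalℕ : Poly → ℕ → ℕ
evalℕ []      x = 0
evalℕ (a ∷ f) x = a + x * evalℕ f x

_⊕_ : Poly → Poly → Poly
[]      ⊕ g       = g
(a ∷ f) ⊕ []      = a ∷ f
(a ∷ f) ⊕ (b ∷ g) = (a + b) ∷ (f ⊕ g)

scale : ℕ → Poly → Poly
scale s f = map (s *_) f

shift : ℕ → Poly → Poly
shift e f = replicate e 0 ++ f

mono : ℕ → ℕ → Poly
mono a e = shift e (a ∷ [])

seriesIn : ℕ → List ℕ → Poly
seriesIn n []      = []
seriesIn n (c ∷ cs) = mono c 0 ⊕ shift n (seriesIn n cs)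

terms : ℕ → Poly → ℕ
terms p f = length (filter (λ a → ¬? ((a mod p) ≟ 0)) f)

HasDegree : ℕ → Poly → ℕ → Set
HasDegree p f d = (coeff f d mod p ≢ 0) × (∀ j → d < j → coeff f j mod p ≡ 0)

NonzeroQR : ℕ → ℕ → Set
NonzeroQR p x = (x mod p ≢ 0) × Σ ℕ (λ y → (y * y) mod p ≡ x mod p)

SqrtRep : ℕ → Poly → Set
SqrtRep p f = ∀ x → NonzeroQR p x → (evalℕ f x * evalℕ f x) mod p ≡ x mod p

-- the inverse of 2 in F_p for odd p: (p + 1)/2, since 2 · (p+1)/2 = p + 1 ≡ 1
inv2 : ℕ → ℕ
inv2 p = (p + 1) / 2

fForm : (p k n : ℕ) → Vec ℕ (2 ^ (k ∸ 1)) → Poly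
fForm p k n c = scale (inv2 p ^ (k ∸ 1)) (shift ((n + 1) / 2) (seriesIn n (toList c)))

{-# OPTIONS --safe #-}
module Submission where

-- Write p − 1 = 2mn with m = 2^(k−1). By root counting, x^(mn) − 1 cannot vanish at all
-- of 1, …, mn + 1, and by Fermat some a then has a^(mn) = −1; so ζ = a^n satisfies
-- ζ^m = −1. Hence w = ζ² has order m, and extracting square roots repeatedly shows that
-- every y with y^m = 1 is a power w^j, j < m. For a nonzero square x, y = x^n is such a
-- root of unity. With η = ζ⁻¹ and v = η², the coefficients c_t = Σ_j η^j v^(jt) are the
-- discrete Fourier transform of j ↦ η^j, so G(y) = Σ_t c_t y^t equals m η^j at y = w^j,
-- and f(x) = m⁻¹ x^((n+1)/2) G(x^n) satisfies f(x)² = x · x^n · η^(2j) = x · w^j v^j = x.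
-- Each c_t = Σ_j (η^(2t+1))^j is a geometric sum whose ratio has m-th power −1, hence
-- c_t ≠ 0, which gives the degree and the number of terms.

open import Defs
open import Data.Nat
  using (ℕ; zero; suc; pred; _+_; _*_; _∸_; _^_; _≤_; _<_; _%_; _/_; z≤n; s≤s; _≟_; _<?_)
open import Data.Nat.Properties
open import Data.Nat.DivMod
  using (m%n%n≡m%n; n%n≡0; m*n%n≡0; m%n<n; m%n≤n; m<n⇒m%n≡m; %-distribˡ-+; %-distribˡ-*;
         m≡m%n+[m/n]*n; m*n/n≡m)
open import Data.Nat.Divisibility using (_∣_; divides; ∣⇒≤; m%n≡0⇒n∣m; n∣m⇒m%n≡0)
open import Data.Nat.Primality using (Prime; euclidsLemma)
open import Data.Nat.Combinatorics using (_C_; nC1≡n; nCn≡1; k>n⇒nCk≡0; nCk+nC[k+1]≡[n+1]C[k+1])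
open import Data.Nat.Tactic.RingSolver using (solve-∀)
open import Data.List using (List; []; _∷_; replicate; _++_; length; map; applyUpTo)
open import Data.List.Properties
  using (length-applyUpTo; length-replicate; length-++; map-applyUpTo; applyUpTo-∷ʳ;
         filter-accept; filter-reject)
open import Data.List.Relation.Unary.All as All using (All; []; _∷_; all?)
open import Data.List.Relation.Unary.All.Properties using (++⁻ʳ; ¬All⇒Any¬; applyUpTo⁺₂)
import Data.List.Relation.Unary.Any.Properties as Any
open import Data.List.Relation.Unary.AllPairs using (AllPairs; []; _∷_)
import Data.List.Relation.Unary.AllPairs.Properties as AllPairs
open import Data.Vec using (Vec; toList)
import Data.Vec as Vec
open import Data.Vec.Properties using (toList-cast; toList∘fromList)
open import Data.Product using (Σ; _×_; _,_; proj₁; proj₂)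
open import Data.Sum as Sum using (_⊎_; inj₁; inj₂)
open import Data.Empty using (⊥-elim)
open import Function using (_∘_; id)
open import Level using (0ℓ)
open import Relation.Nullary using (Dec; yes; no; ¬_)
import Relation.Nullary.Decidable as Dec
open import Relation.Nullary.Decidable using (¬?)
open import Relation.Binary.Bundles using (Setoid)
open import Relation.Binary.Definitions using (tri<; tri≈; tri>)
open import Relation.Binary.PropositionalEquality
import Relation.Binary.Reasoning.Setoid as ≈-Reasoning

-- Arithmetic on ℕ

^-distrib-* : ∀ a b e → (a * b) ^ e ≡ a ^ e * b ^ e
^-distrib-* a b zero    = refl
^-distrib-* a b (suc e) = begin
  a * b * (a * b) ^ e      ≡⟨ cong (a * b *_) (^-distrib-* a b e) ⟩
  a * b * (a ^ e * b ^ e)  ≡⟨ [m*n]*[o*p]≡[m*o]*[n*p] a b (a ^ e) (b ^ e) ⟩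
  a * a ^ e * (b * b ^ e)  ∎
  where open ≡-Reasoning

^-square : ∀ a e → (a * a) ^ e ≡ a ^ (e + e)
^-square a e = begin
  (a * a) ^ e      ≡⟨ ^-distrib-* a a e ⟩
  a ^ e * a ^ e    ≡⟨ ^-distribˡ-+-* a e e ⟨
  a ^ (e + e)      ∎
  where open ≡-Reasoning

^-^-comm : ∀ a b c → (a ^ b) ^ c ≡ (a ^ c) ^ b
^-^-comm a b c = trans (^-*-assoc a b c) (trans (cong (a ^_) (*-comm b c)) (sym (^-*-assoc a c b)))

2^suc : ∀ b → 2 ^ suc b ≡ 2 ^ b + 2 ^ b
2^suc b = cong (2 ^ b +_) (+-identityʳ (2 ^ b))

^-2^suc : ∀ x b → x ^ 2 ^ suc b ≡ (x * x) ^ 2 ^ b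
^-2^suc x b = trans (cong (x ^_) (2^suc b)) (sym (^-square x (2 ^ b)))

m+m<n+n⇒m<n : ∀ {m n} → m + m < n + n → m < n
m+m<n+n⇒m<n {m} {n} m+m<n+n with m <? n
... | yes m<n = m<n
... | no  m≮n = ⊥-elim (<-irrefl refl (<-≤-trans m+m<n+n (+-mono-≤ (≮⇒≥ m≮n) (≮⇒≥ m≮n))))

data Parity : ℕ → Set where
  even : ∀ k → Parity (k + k)
  odd  : ∀ k → Parity (suc (k + k))

parity : ∀ n → Parity n
parity zero    = even 0
parity (suc n) with parity n
... | even k = odd k
... | odd k  = subst Parity (cong suc (+-suc k k)) (even (suc k))

odd⇒≡1+2r : ∀ {n} → n % 2 ≡ 1 → Σ ℕ λ r → n ≡ suc (r + r)
odd⇒≡1+2r {n} n%2≡1 = n / 2 , (begin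
  n                         ≡⟨ m≡m%n+[m/n]*n n 2 ⟩
  n % 2 + n / 2 * 2         ≡⟨ cong (_+ n / 2 * 2) n%2≡1 ⟩
  suc (n / 2 * 2)           ≡⟨ cong suc (double (n / 2)) ⟩
  suc (n / 2 + n / 2)       ∎)
  where
  open ≡-Reasoning
  double : ∀ r → r * 2 ≡ r + r
  double = solve-∀

[1+2r+1]/2≡1+r : ∀ r → (suc (r + r) + 1) / 2 ≡ suc r
[1+2r+1]/2≡1+r r = trans (cong (_/ 2) (double r)) (m*n/n≡m (suc r) 2)
  where
  double : ∀ r → suc (r + r) + 1 ≡ suc r * 2
  double = solve-∀

[1+2r∸1]/2≡r : ∀ r → (suc (r + r) ∸ 1) / 2 ≡ r
[1+2r∸1]/2≡r r = trans (cong (_/ 2) (double r)) (m*n/n≡m r 2)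
  where
  double : ∀ r → r + r ≡ r * 2
  double = solve-∀

[n+1]/2+M*n≡[1+M]*n∸[n∸1]/2 : ∀ M r → let n = suc (r + r) in
  (n + 1) / 2 + M * n ≡ suc M * n ∸ (n ∸ 1) / 2
[n+1]/2+M*n≡[1+M]*n∸[n∸1]/2 M r = begin
  (n + 1) / 2 + M * n         ≡⟨ cong (_+ M * n) ([1+2r+1]/2≡1+r r) ⟩
  suc r + M * n               ≡⟨ m+n∸n≡m (suc r + M * n) r ⟨
  suc r + M * n + r ∸ r       ≡⟨ cong (_∸ r) (rearrange r (M * n)) ⟩
  suc M * n ∸ r               ≡⟨ cong (suc M * n ∸_) ([1+2r∸1]/2≡r r) ⟨
  suc M * n ∸ (n ∸ 1) / 2     ∎
  where
  open ≡-Reasoning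
  n : ℕ
  n = suc (r + r)
  rearrange : ∀ r a → suc r + a + r ≡ suc (r + r) + a
  rearrange = solve-∀

-- Finite sums

sumBelow : ℕ → (ℕ → ℕ) → ℕ
sumBelow zero    f = 0
sumBelow (suc m) f = f 0 + sumBelow m (f ∘ suc)

syntax sumBelow m (λ i → e) = ∑[ i < m ] e

∑-cong : ∀ m {f g : ℕ → ℕ} → (∀ i → f i ≡ g i) → ∑[ i < m ] f i ≡ ∑[ i < m ] g i
∑-cong zero    f≗g = refl
∑-cong (suc m) f≗g = cong₂ _+_ (f≗g 0) (∑-cong m (λ i → f≗g (suc i)))

∑-const : ∀ m a → ∑[ i < m ] a ≡ m * a
∑-const zero    a = refl
∑-const (suc m) a = cong (a +_) (∑-const m a)

∑-distrib-+ : ∀ m (f g : ℕ → ℕ) → ∑[ i < m ] (f i + g i) ≡ ∑[ i < m ] f i + ∑[ i < m ] g i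
∑-distrib-+ zero    f g = refl
∑-distrib-+ (suc m) f g = begin
  f 0 + g 0 + ∑[ i < m ] (f (suc i) + g (suc i))
    ≡⟨ cong (f 0 + g 0 +_) (∑-distrib-+ m (f ∘ suc) (g ∘ suc)) ⟩
  f 0 + g 0 + (∑[ i < m ] f (suc i) + ∑[ i < m ] g (suc i))
    ≡⟨ +-+-interchange (f 0) (g 0) _ _ ⟩
  f 0 + ∑[ i < m ] f (suc i) + (g 0 + ∑[ i < m ] g (suc i))
    ∎
  where
  open ≡-Reasoning
  +-+-interchange : ∀ a b c d → a + b + (c + d) ≡ a + c + (b + d)
  +-+-interchange = solve-∀

*-distribˡ-∑ : ∀ m a (f : ℕ → ℕ) → a * ∑[ i < m ] f i ≡ ∑[ i < m ] (a * f i)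
*-distribˡ-∑ zero    a f = *-zeroʳ a
*-distribˡ-∑ (suc m) a f = trans (*-distribˡ-+ a (f 0) _) (cong (a * f 0 +_) (*-distribˡ-∑ m a (f ∘ suc)))

*-distribʳ-∑ : ∀ m (f : ℕ → ℕ) a → (∑[ i < m ] f i) * a ≡ ∑[ i < m ] (f i * a)
*-distribʳ-∑ m f a = begin
  (∑[ i < m ] f i) * a   ≡⟨ *-comm _ a ⟩
  a * ∑[ i < m ] f i     ≡⟨ *-distribˡ-∑ m a f ⟩
  ∑[ i < m ] (a * f i)   ≡⟨ ∑-cong m (λ i → *-comm a (f i)) ⟩
  ∑[ i < m ] (f i * a)   ∎
  where open ≡-Reasoning

∑-comm : ∀ m n (f : ℕ → ℕ → ℕ) → ∑[ i < m ] ∑[ j < n ] f i j ≡ ∑[ j < n ] ∑[ i < m ] f i j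
∑-comm zero    n f = sym (trans (∑-const n 0) (*-zeroʳ n))
∑-comm (suc m) n f = begin
  ∑[ j < n ] f 0 j + ∑[ i < m ] ∑[ j < n ] f (suc i) j
    ≡⟨ cong (∑[ j < n ] f 0 j +_) (∑-comm m n (f ∘ suc)) ⟩
  ∑[ j < n ] f 0 j + ∑[ j < n ] ∑[ i < m ] f (suc i) j
    ≡⟨ ∑-distrib-+ n (f 0) (λ j → ∑[ i < m ] f (suc i) j) ⟨
  ∑[ j < n ] (f 0 j + ∑[ i < m ] f (suc i) j)
    ∎
  where open ≡-Reasoning

geometric-sum : ∀ m u → u * ∑[ i < m ] (u ^ i) + 1 ≡ u ^ m + ∑[ i < m ] (u ^ i)
geometric-sum zero    u = cong (_+ 1) (*-zeroʳ u)
geometric-sum (suc m) u = begin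
  u * (1 + ∑[ i < m ] (u ^ suc i)) + 1   ≡⟨ cong (λ z → u * (1 + z) + 1) (*-distribˡ-∑ m u (u ^_)) ⟨
  u * (1 + u * S) + 1                  ≡⟨ rearrangeˡ u S ⟩
  u * (u * S + 1) + 1                  ≡⟨ cong (λ z → u * z + 1) (geometric-sum m u) ⟩
  u * (u ^ m + S) + 1                  ≡⟨ rearrangeʳ u (u ^ m) S ⟩
  u * u ^ m + (1 + u * S)              ≡⟨ cong (λ z → u * u ^ m + (1 + z)) (*-distribˡ-∑ m u (u ^_)) ⟩
  u * u ^ m + (1 + ∑[ i < m ] (u ^ suc i)) ∎
  where
  open ≡-Reasoning
  S : ℕ
  S = ∑[ i < m ] (u ^ i)
  rearrangeˡ : ∀ u S → u * (1 + u * S) + 1 ≡ u * (u * S + 1) + 1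
  rearrangeˡ = solve-∀
  rearrangeʳ : ∀ u U S → u * (U + S) + 1 ≡ u * U + (1 + u * S)
  rearrangeʳ = solve-∀

-- Polynomials as coefficient lists

eval-⊕ : ∀ f g x → evalℕ (f ⊕ g) x ≡ evalℕ f x + evalℕ g x
eval-⊕ []      g       x = refl
eval-⊕ (a ∷ f) []      x = sym (+-identityʳ _)
eval-⊕ (a ∷ f) (b ∷ g) x = begin
  a + b + x * evalℕ (f ⊕ g) x                ≡⟨ cong (λ z → a + b + x * z) (eval-⊕ f g x) ⟩
  a + b + x * (evalℕ f x + evalℕ g x)        ≡⟨ rearrange a b x (evalℕ f x) (evalℕ g x) ⟩
  a + x * evalℕ f x + (b + x * evalℕ g x)    ∎
  where
  open ≡-Reasoning
  rearrange : ∀ a b x F G → a + b + x * (F + G) ≡ a + x * F + (b + x * G)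
  rearrange = solve-∀

eval-scale : ∀ s f x → evalℕ (scale s f) x ≡ s * evalℕ f x
eval-scale s []      x = sym (*-zeroʳ s)
eval-scale s (a ∷ f) x = begin
  s * a + x * evalℕ (scale s f) x    ≡⟨ cong (λ z → s * a + x * z) (eval-scale s f x) ⟩
  s * a + x * (s * evalℕ f x)        ≡⟨ rearrange s a x (evalℕ f x) ⟩
  s * (a + x * evalℕ f x)            ∎
  where
  open ≡-Reasoning
  rearrange : ∀ s a x F → s * a + x * (s * F) ≡ s * (a + x * F)
  rearrange = solve-∀

eval-shift : ∀ e f x → evalℕ (shift e f) x ≡ x ^ e * evalℕ f x
eval-shift zero    f x = sym (+-identityʳ _)
eval-shift (suc e) f x = begin
  x * evalℕ (shift e f) x      ≡⟨ cong (x *_) (eval-shift e f x) ⟩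
  x * (x ^ e * evalℕ f x)      ≡⟨ *-assoc x (x ^ e) _ ⟨
  x * x ^ e * evalℕ f x        ∎
  where open ≡-Reasoning

eval-seriesIn : ∀ n cs x → evalℕ (seriesIn n cs) x ≡ evalℕ cs (x ^ n)
eval-seriesIn n []       x = refl
eval-seriesIn n (c ∷ cs) x = begin
  evalℕ ((c ∷ []) ⊕ shift n S) x
    ≡⟨ eval-⊕ (c ∷ []) (shift n S) x ⟩
  c + x * 0 + evalℕ (shift n S) x
    ≡⟨ cong₂ _+_ (trans (cong (c +_) (*-zeroʳ x)) (+-identityʳ c)) (eval-shift n S x) ⟩
  c + x ^ n * evalℕ S x
    ≡⟨ cong (λ z → c + x ^ n * z) (eval-seriesIn n cs x) ⟩
  c + x ^ n * evalℕ cs (x ^ n)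
    ∎
  where
  open ≡-Reasoning
  S : Poly
  S = seriesIn n cs

eval-applyUpTo : ∀ m (f : ℕ → ℕ) y → evalℕ (applyUpTo f m) y ≡ ∑[ t < m ] (f t * y ^ t)
eval-applyUpTo zero    f y = refl
eval-applyUpTo (suc m) f y = cong₂ _+_ (sym (*-identityʳ (f 0))) (begin
  y * evalℕ (applyUpTo (f ∘ suc) m) y       ≡⟨ cong (y *_) (eval-applyUpTo m (f ∘ suc) y) ⟩
  y * ∑[ t < m ] (f (suc t) * y ^ t)        ≡⟨ *-distribˡ-∑ m y (λ t → f (suc t) * y ^ t) ⟩
  ∑[ t < m ] (y * (f (suc t) * y ^ t))      ≡⟨ ∑-cong m (λ t → x∙yz≈y∙xz y (f (suc t)) (y ^ t)) ⟩
  ∑[ t < m ] (f (suc t) * (y * y ^ t))      ∎)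
  where
  open ≡-Reasoning
  x∙yz≈y∙xz : ∀ x y z → x * (y * z) ≡ y * (x * z)
  x∙yz≈y∙xz = solve-∀

coeff-⊕ : ∀ f g j → coeff (f ⊕ g) j ≡ coeff f j + coeff g j
coeff-⊕ []      g       j       = refl
coeff-⊕ (a ∷ f) []      j       = sym (+-identityʳ _)
coeff-⊕ (a ∷ f) (b ∷ g) zero    = refl
coeff-⊕ (a ∷ f) (b ∷ g) (suc j) = coeff-⊕ f g j

coeff-shift-+ : ∀ e f i → coeff (shift e f) (e + i) ≡ coeff f i
coeff-shift-+ zero    f i = refl
coeff-shift-+ (suc e) f i = coeff-shift-+ e f i

coeff-shift-< : ∀ e f {j} → j < e → coeff (shift e f) j ≡ 0
coeff-shift-< (suc e) f {zero}  _         = refl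
coeff-shift-< (suc e) f {suc j} (s≤s j<e) = coeff-shift-< e f j<e

coeff-≥length : ∀ f {j} → length f ≤ j → coeff f j ≡ 0
coeff-≥length []      _         = refl
coeff-≥length (a ∷ f) (s≤s f≤j) = coeff-≥length f f≤j

coeff-shift-≥ : ∀ e f {j} → e + length f ≤ j → coeff (shift e f) j ≡ 0
coeff-shift-≥ zero    f f≤j                 = coeff-≥length f f≤j
coeff-shift-≥ (suc e) f {suc j} (s≤s e+f≤j) = coeff-shift-≥ e f e+f≤j

coeff-shift-[] : ∀ e j → coeff (shift e []) j ≡ 0
coeff-shift-[] zero    j       = refl
coeff-shift-[] (suc e) zero    = refl
coeff-shift-[] (suc e) (suc j) = coeff-shift-[] e j

scale-shift : ∀ s e f → scale s (shift e f) ≡ shift e (scale s f)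
scale-shift s zero    f = refl
scale-shift s (suc e) f = cong₂ _∷_ (*-zeroʳ s) (scale-shift s e f)

scale-seriesIn : ∀ s n' cs → scale s (seriesIn (suc n') cs) ≡ seriesIn (suc n') (map (s *_) cs)
scale-seriesIn s n' []       = refl
scale-seriesIn s n' (c ∷ cs) = cong₂ _∷_ (trans (cong (s *_) (+-identityʳ c)) (sym (+-identityʳ (s * c))))
  (trans (scale-shift s n' (seriesIn (suc n') cs)) (cong (shift n') (scale-seriesIn s n' cs)))

eval-fForm : ∀ p k n c x →
  evalℕ (fForm p k n c) x ≡ inv2 p ^ (k ∸ 1) * (x ^ ((n + 1) / 2) * evalℕ (toList c) (x ^ n))
eval-fForm p k n c x = begin
  evalℕ (scale s (shift e S)) x     ≡⟨ eval-scale s (shift e S) x ⟩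
  s * evalℕ (shift e S) x           ≡⟨ cong (s *_) (eval-shift e S x) ⟩
  s * (x ^ e * evalℕ S x)           ≡⟨ cong (λ z → s * (x ^ e * z)) (eval-seriesIn n (toList c) x) ⟩
  s * (x ^ e * evalℕ (toList c) (x ^ n)) ∎
  where
  open ≡-Reasoning
  s e : ℕ
  s = inv2 p ^ (k ∸ 1)
  e = (n + 1) / 2
  S : Poly
  S = seriesIn n (toList c)

fForm≡shift-seriesIn : ∀ p k n' c → fForm p k (suc n') c ≡
          shift ((suc n' + 1) / 2) (seriesIn (suc n') (map (inv2 p ^ (k ∸ 1) *_) (toList c)))
fForm≡shift-seriesIn p k n' c = trans (scale-shift s e (seriesIn (suc n') (toList c)))
                         (cong (shift e) (scale-seriesIn s n' (toList c)))
  where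
  s e : ℕ
  s = inv2 p ^ (k ∸ 1)
  e = (suc n' + 1) / 2

0-mod≡0 : ∀ p → 0 mod p ≡ 0
0-mod≡0 zero    = refl
0-mod≡0 (suc q) = refl

degree-∷ : ∀ p {f d} a → HasDegree p f d → HasDegree p (a ∷ f) (suc d)
degree-∷ p a (top , beyond) = top , λ { (suc j) (s≤s d<j) → beyond j d<j }

degree-shift : ∀ p {f d} e → HasDegree p f d → HasDegree p (shift e f) (e + d)
degree-shift p zero    deg = deg
degree-shift p (suc e) deg = degree-∷ p 0 (degree-shift p e deg)

-- With step 0 the summands of seriesIn would overlap, hence the step suc n' here and in terms-seriesIn.
degree-seriesIn : ∀ p n' cs {c} → c mod p ≢ 0 →
                  HasDegree p (seriesIn (suc n') (cs ++ c ∷ [])) (length cs * suc n')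
degree-seriesIn p n' []       {c} c≢0 = top , beyond
  where
  top : (c + 0) mod p ≢ 0
  top = subst (λ z → z mod p ≢ 0) (sym (+-identityʳ c)) c≢0
  beyond : ∀ j → 0 < j → coeff (seriesIn (suc n') (c ∷ [])) j mod p ≡ 0
  beyond (suc j) _ = trans (cong (_mod p) (coeff-shift-[] n' j)) (0-mod≡0 p)
degree-seriesIn p n' (a ∷ cs) c≢0 = degree-∷ p (a + 0) (degree-shift p n' (degree-seriesIn p n' cs c≢0))

terms-shift : ∀ p e f → terms p (shift e f) ≡ terms p f
terms-shift p zero    f = refl
terms-shift p (suc e) f =
  trans (cong length (filter-reject (λ a → ¬? ((a mod p) ≟ 0)) (λ 0≢0 → 0≢0 (0-mod≡0 p))))
        (terms-shift p e f)

terms-seriesIn : ∀ p n' cs → All (λ c → c mod p ≢ 0) cs → terms p (seriesIn (suc n') cs) ≡ length cs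
terms-seriesIn p n' []       []             = refl
terms-seriesIn p n' (c ∷ cs) (c≢0 ∷ cs≢0) =
  trans (cong length (filter-accept (λ a → ¬? ((a mod p) ≟ 0))
                        (subst (λ z → z mod p ≢ 0) (sym (+-identityʳ c)) c≢0)))
        (cong suc (trans (terms-shift p n' (seriesIn (suc n') cs)) (terms-seriesIn p n' cs cs≢0)))

[k+1]*[n+1]C[k+1]≡[n+1]*nCk : ∀ n k → suc k * (suc n C suc k) ≡ suc n * (n C k)
[k+1]*[n+1]C[k+1]≡[n+1]*nCk n       zero    =
  trans (+-identityʳ (suc n C 1)) (trans (nC1≡n (suc n)) (sym (*-identityʳ (suc n))))
[k+1]*[n+1]C[k+1]≡[n+1]*nCk zero    (suc k) = *-zeroʳ (suc (suc k))
[k+1]*[n+1]C[k+1]≡[n+1]*nCk (suc n) (suc k) = begin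
  suc (suc k) * (suc (suc n) C suc (suc k))
    ≡⟨ cong (suc (suc k) *_) (nCk+nC[k+1]≡[n+1]C[k+1] (suc n) (suc k)) ⟨
  suc (suc k) * (Y + X)
    ≡⟨ rearrangeˡ k X Y ⟩
  suc (suc k) * X + suc k * Y + Y
    ≡⟨ cong₂ (λ a b → a + b + Y) ([k+1]*[n+1]C[k+1]≡[n+1]*nCk n (suc k))
                                 ([k+1]*[n+1]C[k+1]≡[n+1]*nCk n k) ⟩
  suc n * (n C suc k) + suc n * (n C k) + Y
    ≡⟨ cong (suc n * (n C suc k) + suc n * (n C k) +_) (nCk+nC[k+1]≡[n+1]C[k+1] n k) ⟨
  suc n * (n C suc k) + suc n * (n C k) + (n C k + n C suc k)
    ≡⟨ rearrangeʳ n (n C k) (n C suc k) ⟩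
  suc (suc n) * (n C k + n C suc k)
    ≡⟨ cong (suc (suc n) *_) (nCk+nC[k+1]≡[n+1]C[k+1] n k) ⟩
  suc (suc n) * (suc n C suc k)
    ∎
  where
  open ≡-Reasoning
  X Y : ℕ
  X = suc n C suc (suc k)
  Y = suc n C suc k
  rearrangeˡ : ∀ k X Y → suc (suc k) * (Y + X) ≡ suc (suc k) * X + suc k * Y + Y
  rearrangeˡ = solve-∀
  rearrangeʳ : ∀ n a b → suc n * b + suc n * a + (a + b) ≡ suc (suc n) * (a + b)
  rearrangeʳ = solve-∀

binomialRow : ℕ → Poly
binomialRow zero    = 1 ∷ []
binomialRow (suc n) = binomialRow n ⊕ (0 ∷ binomialRow n)

eval-binomialRow : ∀ n x → evalℕ (binomialRow n) x ≡ (1 + x) ^ n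
eval-binomialRow zero    x = cong suc (*-zeroʳ x)
eval-binomialRow (suc n) x = begin
  evalℕ (binomialRow n ⊕ (0 ∷ binomialRow n)) x            ≡⟨ eval-⊕ (binomialRow n) (0 ∷ binomialRow n) x ⟩
  evalℕ (binomialRow n) x + x * evalℕ (binomialRow n) x    ≡⟨ cong (λ z → z + x * z) (eval-binomialRow n x) ⟩
  (1 + x) ^ suc n                                          ∎
  where open ≡-Reasoning

coeff-binomialRow : ∀ n j → coeff (binomialRow n) j ≡ n C j
coeff-binomialRow zero    zero    = refl
coeff-binomialRow zero    (suc j) = refl
coeff-binomialRow (suc n) zero    =
  trans (coeff-⊕ (binomialRow n) (0 ∷ binomialRow n) 0)
        (trans (+-identityʳ _) (coeff-binomialRow n 0))
coeff-binomialRow (suc n) (suc j) = begin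
  coeff (binomialRow n ⊕ (0 ∷ binomialRow n)) (suc j)
    ≡⟨ coeff-⊕ (binomialRow n) (0 ∷ binomialRow n) (suc j) ⟩
  coeff (binomialRow n) (suc j) + coeff (binomialRow n) j
    ≡⟨ cong₂ _+_ (coeff-binomialRow n (suc j)) (coeff-binomialRow n j) ⟩
  n C suc j + n C j
    ≡⟨ +-comm (n C suc j) (n C j) ⟩
  n C j + n C suc j
    ≡⟨ nCk+nC[k+1]≡[n+1]C[k+1] n j ⟩
  suc n C suc j
    ∎
  where open ≡-Reasoning

quotientByRoot : ℕ → Poly → Poly
quotientByRoot r []          = []
quotientByRoot r (a ∷ [])    = []
quotientByRoot r (a ∷ b ∷ f) = evalℕ (b ∷ f) r ∷ quotientByRoot r (b ∷ f)

length-quotientByRoot : ∀ r f → length (quotientByRoot r f) ≡ length f ∸ 1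
length-quotientByRoot r []          = refl
length-quotientByRoot r (a ∷ [])    = refl
length-quotientByRoot r (a ∷ b ∷ f) = cong suc (length-quotientByRoot r (b ∷ f))

-- f(x) − f(r) = (x − r) Q(x) for Q = quotientByRoot r f, with both sides moved so that no
-- subtraction occurs.
quotientByRoot-spec : ∀ r f x →
  x * evalℕ (quotientByRoot r f) x + evalℕ f r ≡ evalℕ f x + r * evalℕ (quotientByRoot r f) x
quotientByRoot-spec r []          x = trans (+-identityʳ (x * 0)) (trans (*-zeroʳ x) (sym (*-zeroʳ r)))
quotientByRoot-spec r (a ∷ [])    x = constant x a r
  where
  constant : ∀ x a r → x * 0 + (a + r * 0) ≡ a + x * 0 + r * 0
  constant = solve-∀
quotientByRoot-spec r (a ∷ b ∷ f) x = begin
  x * (E + x * Q) + (a + r * E)      ≡⟨ rearrangeˡ x E Q a r ⟩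
  a + r * E + x * (x * Q + E)        ≡⟨ cong (λ z → a + r * E + x * z) (quotientByRoot-spec r (b ∷ f) x) ⟩
  a + r * E + x * (P + r * Q)        ≡⟨ rearrangeʳ x E Q a r P ⟩
  a + x * P + r * (E + x * Q)        ∎
  where
  open ≡-Reasoning
  E Q P : ℕ
  E = evalℕ (b ∷ f) r
  Q = evalℕ (quotientByRoot r (b ∷ f)) x
  P = evalℕ (b ∷ f) x
  rearrangeˡ : ∀ x E Q a r → x * (E + x * Q) + (a + r * E) ≡ a + r * E + x * (x * Q + E)
  rearrangeˡ = solve-∀
  rearrangeʳ : ∀ x E Q a r P → a + r * E + x * (P + r * Q) ≡ a + x * P + r * (E + x * Q)
  rearrangeʳ = solve-∀

-- Arithmetic modulo p

module Modular (q : ℕ) where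

  p : ℕ
  p = suc q

  infix 4 _≈_ _≈?_

  -- Congruence modulo p = suc q, so that p ≢ 0 and a mod p computes as a % p. It is a
  -- record rather than an alias so that a and b can be inferred from a proof of a ≈ b.
  record _≈_ (a b : ℕ) : Set where
    constructor ⟪_⟫
    field
      residue-≡ : a % p ≡ b % p
  open _≈_ public

  ≈-refl : ∀ {a} → a ≈ a
  ≈-refl = ⟪ refl ⟫

  ≈-sym : ∀ {a b} → a ≈ b → b ≈ a
  ≈-sym ⟪ a≡b ⟫ = ⟪ sym a≡b ⟫

  ≈-trans : ∀ {a b c} → a ≈ b → b ≈ c → a ≈ c
  ≈-trans ⟪ a≡b ⟫ ⟪ b≡c ⟫ = ⟪ trans a≡b b≡c ⟫

  ≈-reflexive : ∀ {a b} → a ≡ b → a ≈ b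
  ≈-reflexive refl = ≈-refl

  ≈-setoid : Setoid 0ℓ 0ℓ
  ≈-setoid = record
    { Carrier       = ℕ
    ; _≈_           = _≈_
    ; isEquivalence = record { refl = ≈-refl ; sym = ≈-sym ; trans = ≈-trans }
    }

  _≈?_ : ∀ a b → Dec (a ≈ b)
  a ≈? b = Dec.map′ ⟪_⟫ residue-≡ (a % p ≟ b % p)

  +-cong : ∀ {a b c d} → a ≈ b → c ≈ d → a + c ≈ b + d
  +-cong {a} {b} {c} {d} ⟪ a≡b ⟫ ⟪ c≡d ⟫ = ⟪ begin
    (a + c) % p              ≡⟨ %-distribˡ-+ a c p ⟩
    (a % p + c % p) % p      ≡⟨ cong₂ (λ x y → (x + y) % p) a≡b c≡d ⟩
    (b % p + d % p) % p      ≡⟨ %-distribˡ-+ b d p ⟨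
    (b + d) % p              ∎ ⟫
    where open ≡-Reasoning

  *-cong : ∀ {a b c d} → a ≈ b → c ≈ d → a * c ≈ b * d
  *-cong {a} {b} {c} {d} ⟪ a≡b ⟫ ⟪ c≡d ⟫ = ⟪ begin
    (a * c) % p              ≡⟨ %-distribˡ-* a c p ⟩
    (a % p * (c % p)) % p    ≡⟨ cong₂ (λ x y → (x * y) % p) a≡b c≡d ⟩
    (b % p * (d % p)) % p    ≡⟨ %-distribˡ-* b d p ⟨
    (b * d) % p              ∎ ⟫
    where open ≡-Reasoning

  +-congˡ : ∀ a {b c} → b ≈ c → a + b ≈ a + c
  +-congˡ a = +-cong (≈-refl {a})

  +-congʳ : ∀ a {b c} → b ≈ c → b + a ≈ c + a
  +-congʳ a b≈c = +-cong b≈c (≈-refl {a})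

  *-congˡ : ∀ a {b c} → b ≈ c → a * b ≈ a * c
  *-congˡ a = *-cong (≈-refl {a})

  *-congʳ : ∀ a {b c} → b ≈ c → b * a ≈ c * a
  *-congʳ a b≈c = *-cong b≈c (≈-refl {a})

  ^-congˡ : ∀ e {a b} → a ≈ b → a ^ e ≈ b ^ e
  ^-congˡ zero    a≈b = ≈-refl
  ^-congˡ (suc e) a≈b = *-cong a≈b (^-congˡ e a≈b)

  %-≈ : ∀ a → a % p ≈ a
  %-≈ a = ⟪ m%n%n≡m%n a p ⟫

  *p≈0 : ∀ a → a * p ≈ 0
  *p≈0 a = ⟪ m*n%n≡0 a p ⟫

  ≈0⇒∣ : ∀ {a} → a ≈ 0 → p ∣ a
  ≈0⇒∣ {a} ⟪ a%p≡0 ⟫ = m%n≡0⇒n∣m a p a%p≡0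

  ∣⇒≈0 : ∀ {a} → p ∣ a → a ≈ 0
  ∣⇒≈0 {a} p∣a = ⟪ n∣m⇒m%n≡0 a p p∣a ⟫

  <p∧≈0⇒≡0 : ∀ {a} → a < p → a ≈ 0 → a ≡ 0
  <p∧≈0⇒≡0 a<p ⟪ a%p≡0 ⟫ = trans (sym (m<n⇒m%n≡m a<p)) a%p≡0

  <p-injective : ∀ {a b} → a < p → b < p → a ≈ b → a ≡ b
  <p-injective a<p b<p ⟪ a≡b ⟫ = trans (sym (m<n⇒m%n≡m a<p)) (trans a≡b (m<n⇒m%n≡m b<p))

  q+1≈0 : q + 1 ≈ 0
  q+1≈0 = ⟪ trans (cong (_% p) (+-comm q 1)) (n%n≡0 p) ⟫

  open ≈-Reasoning ≈-setoid

  +-inverse : ∀ a → Σ ℕ λ b → b + a ≈ 0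
  +-inverse a = p ∸ a % p , (begin
    p ∸ a % p + a                            ≡⟨ cong (p ∸ a % p +_) (m≡m%n+[m/n]*n a p) ⟩
    p ∸ a % p + (a % p + a / p * p)          ≡⟨ +-assoc (p ∸ a % p) (a % p) _ ⟨
    p ∸ a % p + a % p + a / p * p            ≡⟨ cong (_+ a / p * p) (m∸n+n≡m (m%n≤n a p)) ⟩
    suc (a / p) * p                          ≈⟨ *p≈0 (suc (a / p)) ⟩
    0                                        ∎)

  +-cancelˡ : ∀ a {b c} → a + b ≈ a + c → b ≈ c
  +-cancelˡ a {b} {c} a+b≈a+c = begin
    b              ≈⟨ +-congʳ b (-a+a≈0) ⟨
    -a + a + b     ≡⟨ +-assoc -a a b ⟩
    -a + (a + b)   ≈⟨ +-congˡ -a a+b≈a+c ⟩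
    -a + (a + c)   ≡⟨ +-assoc -a a c ⟨
    -a + a + c     ≈⟨ +-congʳ c -a+a≈0 ⟩
    c              ∎
    where
    -a : ℕ
    -a = proj₁ (+-inverse a)
    -a+a≈0 : -a + a ≈ 0
    -a+a≈0 = proj₂ (+-inverse a)

  +-cancelʳ : ∀ a {b c} → b + a ≈ c + a → b ≈ c
  +-cancelʳ a {b} {c} b+a≈c+a =
    +-cancelˡ a (≈-trans (≈-reflexive (+-comm a b)) (≈-trans b+a≈c+a (≈-reflexive (+-comm c a))))

  -1²≈1 : ∀ {z} → z + 1 ≈ 0 → z * z ≈ 1
  -1²≈1 {z} z+1≈0 = +-cancelʳ z (begin
    z * z + z        ≡⟨ cong (z * z +_) (*-identityʳ z) ⟨
    z * z + z * 1    ≡⟨ *-distribˡ-+ z z 1 ⟨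
    z * (z + 1)      ≈⟨ *-congˡ z z+1≈0 ⟩
    z * 0            ≡⟨ *-zeroʳ z ⟩
    0                ≈⟨ z+1≈0 ⟨
    z + 1            ≡⟨ +-comm z 1 ⟩
    1 + z            ∎)

  -1^even : ∀ {z} t → z + 1 ≈ 0 → z ^ (t + t) ≈ 1
  -1^even {z} t z+1≈0 = begin
    z ^ (t + t)      ≡⟨ ^-square z t ⟨
    (z * z) ^ t      ≈⟨ ^-congˡ t (-1²≈1 z+1≈0) ⟩
    1 ^ t            ≡⟨ ^-zeroˡ t ⟩
    1                ∎

  -1^odd : ∀ {z} t → z + 1 ≈ 0 → z ^ suc (t + t) + 1 ≈ 0
  -1^odd {z} t z+1≈0 = begin
    z * z ^ (t + t) + 1    ≈⟨ +-congʳ 1 (*-congˡ z (-1^even t z+1≈0)) ⟩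
    z * 1 + 1              ≡⟨ cong (_+ 1) (*-identityʳ z) ⟩
    z + 1                  ≈⟨ z+1≈0 ⟩
    0                      ∎

  ∑-cong≈ : ∀ m {f g : ℕ → ℕ} → (∀ i → f i ≈ g i) → ∑[ i < m ] f i ≈ ∑[ i < m ] g i
  ∑-cong≈ zero    f≈g = ≈-refl
  ∑-cong≈ (suc m) f≈g = +-cong (f≈g 0) (∑-cong≈ m (f≈g ∘ suc))

  ∑-≈0 : ∀ m (f : ℕ → ℕ) → (∀ i → i < m → f i ≈ 0) → ∑[ i < m ] f i ≈ 0
  ∑-≈0 zero    f f≈0 = ≈-refl
  ∑-≈0 (suc m) f f≈0 = +-cong (f≈0 0 (s≤s z≤n)) (∑-≈0 m (f ∘ suc) (λ i i<m → f≈0 (suc i) (s≤s i<m)))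

  ∑-single : ∀ m (f : ℕ → ℕ) {i₀} → i₀ < m → (∀ i → i < m → i ≢ i₀ → f i ≈ 0) →
             ∑[ i < m ] f i ≈ f i₀
  ∑-single (suc m) f {zero}   _           f≈0 =
    ≈-trans (+-congˡ (f 0) (∑-≈0 m (f ∘ suc) (λ i i<m → f≈0 (suc i) (s≤s i<m) λ ())))
            (≈-reflexive (+-identityʳ (f 0)))
  ∑-single (suc m) f {suc i₀} (s≤s i₀<m) f≈0 =
    ≈-trans (+-congʳ _ (f≈0 0 (s≤s z≤n) λ ()))
            (∑-single m (f ∘ suc) i₀<m λ i i<m i≢i₀ → f≈0 (suc i) (s≤s i<m) (i≢i₀ ∘ suc-injective))

  powers-inverse : ∀ {a b} → a * b ≈ 1 → ∀ e → a ^ e * b ^ e ≈ 1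
  powers-inverse {a} {b} ab≈1 e = begin
    a ^ e * b ^ e    ≡⟨ ^-distrib-* a b e ⟨
    (a * b) ^ e      ≈⟨ ^-congˡ e ab≈1 ⟩
    1 ^ e            ≡⟨ ^-zeroˡ e ⟩
    1                ∎

  powers-cancel : ∀ {a b} → b * a ≈ 1 → ∀ j d → b ^ j * a ^ (j + d) ≈ a ^ d
  powers-cancel {a} {b} ba≈1 j d = begin
    b ^ j * a ^ (j + d)       ≡⟨ cong (b ^ j *_) (^-distribˡ-+-* a j d) ⟩
    b ^ j * (a ^ j * a ^ d)   ≡⟨ *-assoc (b ^ j) (a ^ j) (a ^ d) ⟨
    b ^ j * a ^ j * a ^ d     ≈⟨ *-congʳ (a ^ d) (powers-inverse ba≈1 j) ⟩
    1 * a ^ d                 ≡⟨ *-identityˡ (a ^ d) ⟩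
    a ^ d                     ∎

  module _ (2≉0 : ¬ 2 ≈ 0) where

    -- For even e pass to x²; for odd e, (x²)^(e 2^b) = (x^(2^(b+1)))^e ≈ (−1)^e ≈ −1.
    x²-order : ∀ b {x} → x ^ 2 ^ b + 1 ≈ 0 → ∀ e → 0 < e → e < 2 ^ b → ¬ (x * x) ^ e ≈ 1
    x²-order zero    _ (suc e) _ (s≤s ())
    x²-order (suc b) {x} x^2^[1+b]+1≈0 e 0<e e<2^[1+b] x²ᵉ≈1 with parity e
    ... | even k = x²-order b {x * x} (≈-trans (≈-reflexive (cong (_+ 1) (sym (^-2^suc x b)))) x^2^[1+b]+1≈0)
                     k (m+m<n+n⇒m<n 0<e) (m+m<n+n⇒m<n (subst (k + k <_) (2^suc b) e<2^[1+b]))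
                     (≈-trans (≈-reflexive (^-square (x * x) k)) x²ᵉ≈1)
    ... | odd k = 2≉0 (begin
      1 + 1         ≈⟨ +-congʳ 1 zᵉ≈1 ⟨
      z ^ e + 1     ≈⟨ -1^odd k x^2^[1+b]+1≈0 ⟩
      0             ∎)
      where
      z : ℕ
      z = x ^ 2 ^ suc b
      zᵉ≈1 : z ^ e ≈ 1
      zᵉ≈1 = begin
        z ^ e                        ≡⟨ cong (_^ e) (^-2^suc x b) ⟩
        ((x * x) ^ 2 ^ b) ^ e        ≡⟨ ^-*-assoc (x * x) (2 ^ b) e ⟩
        (x * x) ^ (2 ^ b * e)        ≡⟨ cong ((x * x) ^_) (*-comm (2 ^ b) e) ⟩
        (x * x) ^ (e * 2 ^ b)        ≡⟨ ^-*-assoc (x * x) e (2 ^ b) ⟨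
        ((x * x) ^ e) ^ 2 ^ b        ≈⟨ ^-congˡ (2 ^ b) x²ᵉ≈1 ⟩
        1 ^ 2 ^ b                    ≡⟨ ^-zeroˡ (2 ^ b) ⟩
        1                            ∎

    geometric-sum≉0 : ∀ m {u} → u ^ m + 1 ≈ 0 → ¬ ∑[ i < m ] (u ^ i) ≈ 0
    geometric-sum≉0 m {u} uᵐ+1≈0 S≈0 = 2≉0 (begin
      1 + 1                       ≡⟨ cong (λ z → z + 1 + 1) (*-zeroʳ u) ⟨
      u * 0 + 1 + 1               ≈⟨ +-congʳ 1 (+-congʳ 1 (*-congˡ u S≈0)) ⟨
      u * S + 1 + 1               ≡⟨ cong (_+ 1) (geometric-sum m u) ⟩
      u ^ m + S + 1               ≈⟨ +-congʳ 1 (+-congˡ (u ^ m) S≈0) ⟩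
      u ^ m + 0 + 1               ≡⟨ cong (_+ 1) (+-identityʳ (u ^ m)) ⟩
      u ^ m + 1                   ≈⟨ uᵐ+1≈0 ⟩
      0                           ∎)
      where
      S : ℕ
      S = ∑[ i < m ] (u ^ i)

  eval-≈0 : ∀ f x → (∀ j → coeff f j ≈ 0) → evalℕ f x ≈ 0
  eval-≈0 []      x f≈0 = ≈-refl
  eval-≈0 (a ∷ f) x f≈0 = begin
    a + x * evalℕ f x   ≈⟨ +-cong (f≈0 0) (*-congˡ x (eval-≈0 f x (f≈0 ∘ suc))) ⟩
    0 + x * 0           ≡⟨ *-zeroʳ x ⟩
    0                   ∎

  eval-cong-coeff : ∀ f g x → (∀ j → coeff f j ≈ coeff g j) → evalℕ f x ≈ evalℕ g x
  eval-cong-coeff []      g       x f≈g = ≈-sym (eval-≈0 g x (≈-sym ∘ f≈g))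
  eval-cong-coeff (a ∷ f) []      x f≈g = eval-≈0 (a ∷ f) x f≈g
  eval-cong-coeff (a ∷ f) (b ∷ g) x f≈g =
    +-cong (f≈g 0) (*-congˡ x (eval-cong-coeff f g x (f≈g ∘ suc)))

module PrimeField (q : ℕ) (prime : Prime (suc q)) where

  open Modular q
  open ≈-Reasoning ≈-setoid

  *-≈0 : ∀ a b → a * b ≈ 0 → a ≈ 0 ⊎ b ≈ 0
  *-≈0 a b ab≈0 = Sum.map ∣⇒≈0 ∣⇒≈0 (euclidsLemma a b prime (≈0⇒∣ ab≈0))

  private
    *-cancelˡ-residue≤ : ∀ a {b c} → b % p ≤ c % p → a * b ≈ a * c → a ≈ 0 ⊎ b ≈ c
    *-cancelˡ-residue≤ a {b} {c} b≤c ab≈ac = Sum.map₂ d≈0⇒b≈c (*-≈0 a d ad≈0)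
      where
      d : ℕ
      d = c % p ∸ b % p
      ad≈0 : a * d ≈ 0
      ad≈0 = ≈-sym (+-cancelˡ (a * b) (begin
        a * b + 0               ≡⟨ +-identityʳ (a * b) ⟩
        a * b                   ≈⟨ ab≈ac ⟩
        a * c                   ≈⟨ *-congˡ a (%-≈ c) ⟨
        a * (c % p)             ≡⟨ cong (a *_) (m+[n∸m]≡n b≤c) ⟨
        a * (b % p + d)         ≡⟨ *-distribˡ-+ a (b % p) d ⟩
        a * (b % p) + a * d     ≈⟨ +-congʳ (a * d) (*-congˡ a (%-≈ b)) ⟩
        a * b + a * d           ∎))
      d<p : d < p
      d<p = ≤-<-trans (m∸n≤m (c % p) (b % p)) (m%n<n c p)
      d≈0⇒b≈c : d ≈ 0 → b ≈ c
      d≈0⇒b≈c d≈0 = begin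
        b             ≈⟨ %-≈ b ⟨
        b % p         ≡⟨ +-identityʳ (b % p) ⟨
        b % p + 0     ≡⟨ cong (b % p +_) (<p∧≈0⇒≡0 d<p d≈0) ⟨
        b % p + d     ≡⟨ m+[n∸m]≡n b≤c ⟩
        c % p         ≈⟨ %-≈ c ⟩
        c             ∎

  *-cancelˡ : ∀ a {b c} → a * b ≈ a * c → a ≈ 0 ⊎ b ≈ c
  *-cancelˡ a {b} {c} ab≈ac with ≤-total (b % p) (c % p)
  ... | inj₁ b≤c = *-cancelˡ-residue≤ a b≤c ab≈ac
  ... | inj₂ c≤b = Sum.map₂ ≈-sym (*-cancelˡ-residue≤ a c≤b (≈-sym ab≈ac))

  square-≈⇒± : ∀ a b → a * a ≈ b * b → a ≈ b ⊎ a + b ≈ 0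
  square-≈⇒± a b a²≈b² = Sum.swap (*-cancelˡ (a + b) (begin
    (a + b) * a      ≡⟨ *-distribʳ-+ a a b ⟩
    a * a + b * a    ≈⟨ +-congʳ (b * a) a²≈b² ⟩
    b * b + b * a    ≡⟨ +-comm (b * b) (b * a) ⟩
    b * a + b * b    ≡⟨ cong (_+ b * b) (*-comm b a) ⟩
    a * b + b * b    ≡⟨ *-distribʳ-+ b a b ⟨
    (a + b) * b      ∎))

  p∣pC[1+k] : ∀ k → k < q → p ∣ p C suc k
  p∣pC[1+k] k k<q with euclidsLemma (suc k) (p C suc k) prime
                         (divides (q C k) (trans ([k+1]*[n+1]C[k+1]≡[n+1]*nCk q k) (*-comm p (q C k))))
  ... | inj₁ p∣1+k  = ⊥-elim (<⇒≱ (s≤s k<q) (∣⇒≤ p∣1+k))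
  ... | inj₂ p∣pC   = p∣pC

  frobenius : ∀ x → (1 + x) ^ p ≈ 1 + x ^ p
  frobenius x = begin
    (1 + x) ^ p                          ≡⟨ eval-binomialRow p x ⟨
    evalℕ (binomialRow p) x              ≈⟨ eval-cong-coeff (binomialRow p) 1+xᵖ x binomialRow≈1+xᵖ ⟩
    1 + x * evalℕ (shift q (1 ∷ [])) x   ≡⟨ cong (λ z → 1 + x * z) (eval-shift q (1 ∷ []) x) ⟩
    1 + x * (x ^ q * (1 + x * 0))        ≡⟨ cong (λ z → 1 + x * (x ^ q * (1 + z))) (*-zeroʳ x) ⟩
    1 + x * (x ^ q * 1)                  ≡⟨ cong (λ z → 1 + x * z) (*-identityʳ (x ^ q)) ⟩
    1 + x ^ p                            ∎
    where
    1+xᵖ : Poly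
    1+xᵖ = 1 ∷ shift q (1 ∷ [])
    binomialRow≈1+xᵖ : ∀ j → coeff (binomialRow p) j ≈ coeff 1+xᵖ j
    binomialRow≈1+xᵖ zero    = ≈-reflexive (coeff-binomialRow p 0)
    binomialRow≈1+xᵖ (suc j) with <-cmp j q
    ... | tri< j<q _ _ = begin
      coeff (binomialRow p) (suc j)   ≡⟨ coeff-binomialRow p (suc j) ⟩
      p C suc j                       ≈⟨ ∣⇒≈0 (p∣pC[1+k] j j<q) ⟩
      0                               ≡⟨ coeff-shift-< q (1 ∷ []) j<q ⟨
      coeff (shift q (1 ∷ [])) j      ∎
    ... | tri≈ _ refl _ = begin
      coeff (binomialRow p) p         ≡⟨ coeff-binomialRow p p ⟩
      p C p                           ≡⟨ nCn≡1 p ⟩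
      1                               ≡⟨ coeff-shift-+ q (1 ∷ []) 0 ⟨
      coeff (shift q (1 ∷ [])) (q + 0) ≡⟨ cong (coeff (shift q (1 ∷ []))) (+-identityʳ q) ⟩
      coeff (shift q (1 ∷ [])) q      ∎
    ... | tri> _ _ j>q = begin
      coeff (binomialRow p) (suc j)   ≡⟨ coeff-binomialRow p (suc j) ⟩
      p C suc j                       ≡⟨ k>n⇒nCk≡0 (s≤s j>q) ⟩
      0                               ≡⟨ coeff-shift-≥ q (1 ∷ []) (subst (_≤ j) (+-comm 1 q) j>q) ⟨
      coeff (shift q (1 ∷ [])) j      ∎

  fermat-little : ∀ a → a ^ p ≈ a
  fermat-little zero    = ≈-refl
  fermat-little (suc a) = ≈-trans (frobenius a) (+-congˡ 1 (fermat-little a))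

  fermat : ∀ {a} → ¬ a ≈ 0 → a ^ q ≈ 1
  fermat {a} a≉0 = Sum.[ ⊥-elim ∘ a≉0 , id ]′
    (*-cancelˡ a (≈-trans (fermat-little a) (≈-reflexive (sym (*-identityʳ a)))))

  quotientByRoot-root : ∀ f {r s} → evalℕ f r ≈ 0 → evalℕ f s ≈ 0 → ¬ s ≈ r →
                        evalℕ (quotientByRoot r f) s ≈ 0
  quotientByRoot-root f {r} {s} fr≈0 fs≈0 s≉r =
    Sum.[ id , ⊥-elim ∘ s≉r ]′ (*-cancelˡ Q (begin
      Q * s             ≡⟨ *-comm Q s ⟩
      s * Q             ≡⟨ +-identityʳ (s * Q) ⟨
      s * Q + 0         ≈⟨ +-congˡ (s * Q) fr≈0 ⟨
      s * Q + evalℕ f r ≡⟨ quotientByRoot-spec r f s ⟩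
      evalℕ f s + r * Q ≈⟨ +-congʳ (r * Q) fs≈0 ⟩
      r * Q             ≡⟨ *-comm r Q ⟩
      Q * r             ∎))
    where
    Q : ℕ
    Q = evalℕ (quotientByRoot r f) s

  quotientByRoot≈0⇒≈0 : ∀ r f → All (_≈ 0) (quotientByRoot r f) → evalℕ f r ≈ 0 → All (_≈ 0) f
  quotientByRoot≈0⇒≈0 r []          _           _     = []
  quotientByRoot≈0⇒≈0 r (a ∷ [])    _           fr≈0 =
    ≈-trans (≈-reflexive (sym (trans (cong (a +_) (*-zeroʳ r)) (+-identityʳ a)))) fr≈0 ∷ []
  quotientByRoot≈0⇒≈0 r (a ∷ b ∷ f) (e≈0 ∷ Q≈0) fr≈0 =
    a≈0 ∷ quotientByRoot≈0⇒≈0 r (b ∷ f) Q≈0 e≈0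
    where
    a≈0 : a ≈ 0
    a≈0 = begin
      a                         ≡⟨ trans (cong (a +_) (*-zeroʳ r)) (+-identityʳ a) ⟨
      a + r * 0                 ≈⟨ +-congˡ a (*-congˡ r e≈0) ⟨
      a + r * evalℕ (b ∷ f) r   ≈⟨ fr≈0 ⟩
      0                         ∎

  roots⇒zero : ∀ rs f → AllPairs (λ a b → ¬ a ≈ b) rs → length f ≤ length rs →
               All (λ r → evalℕ f r ≈ 0) rs → All (_≈ 0) f
  roots⇒zero []       []    _               _   _               = []
  roots⇒zero (r ∷ rs) f     (r≉rs ∷ rs≉rs) f≤rs (fr≈0 ∷ frs≈0) =
    quotientByRoot≈0⇒≈0 r f (roots⇒zero rs (quotientByRoot r f) rs≉rs Q≤rs Qrs≈0) fr≈0
    where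
    Q≤rs : length (quotientByRoot r f) ≤ length rs
    Q≤rs = subst (_≤ length rs) (sym (length-quotientByRoot r f)) (∸-monoˡ-≤ 1 f≤rs)
    Qrs≈0 : All (λ s → evalℕ (quotientByRoot r f) s ≈ 0) rs
    Qrs≈0 = All.zipWith (λ (r≉s , fs≈0) → quotientByRoot-root f fr≈0 fs≈0 (r≉s ∘ ≈-sym))
                        (r≉rs , frs≈0)

  -- Since q ≈ −1, xʰ-1 is x^h − 1; having at most h roots, it misses some a ≤ h + 1, and then
  -- a^h ≈ −1 because (a^h)² = a^q ≈ 1.
  private module NonResidue (h' : ℕ) (q≡h+h : q ≡ suc h' + suc h') where

    private
      h : ℕ
      h = suc h'
      candidates : List ℕ
      candidates = applyUpTo suc (suc h)
      candidate<p : ∀ {a} → a ≤ suc h → a < p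
      candidate<p a≤1+h = s≤s (≤-trans a≤1+h (subst (suc h ≤_) (sym q≡h+h) (s≤s (m≤n+m (suc h') h'))))
      candidates-distinct : AllPairs (λ a b → ¬ a ≈ b) candidates
      candidates-distinct = AllPairs.applyUpTo⁺₁ suc (suc h) λ {i} {j} i<j j<1+h i≈j →
        <-irrefl (<p-injective (candidate<p (<-trans i<j j<1+h)) (candidate<p j<1+h) i≈j) (s≤s i<j)
      xʰ-1 : Poly
      xʰ-1 = q ∷ shift h' (1 ∷ [])
      xʰ-1≤candidates : length xʰ-1 ≤ length candidates
      xʰ-1≤candidates = ≤-reflexive (trans (cong suc (trans (length-++ (replicate h' 0))
        (trans (cong (_+ 1) (length-replicate h')) (+-comm h' 1)))) (sym (length-applyUpTo suc (suc h))))
      xʰ-1-root : ∀ x → x ^ h ≈ 1 → evalℕ xʰ-1 x ≈ 0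
      xʰ-1-root x xʰ≈1 = begin
        q + x * evalℕ (shift h' (1 ∷ [])) x   ≡⟨ cong (λ z → q + x * z) (eval-shift h' (1 ∷ []) x) ⟩
        q + x * (x ^ h' * (1 + x * 0))        ≡⟨ cong (λ z → q + x * (x ^ h' * (1 + z))) (*-zeroʳ x) ⟩
        q + x * (x ^ h' * 1)                  ≡⟨ cong (λ z → q + x * z) (*-identityʳ (x ^ h')) ⟩
        q + x ^ h                             ≈⟨ +-congˡ q xʰ≈1 ⟩
        q + 1                                 ≈⟨ q+1≈0 ⟩
        0                                     ∎

    -1-is-power : Σ ℕ λ a → a ^ h + 1 ≈ 0
    -1-is-power with all? (λ a → a ^ h ≈? 1) candidates
    ... | yes all-roots
        with _ ∷ ones ← roots⇒zero candidates xʰ-1 candidates-distinct xʰ-1≤candidates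
                          (All.map (λ {x} → xʰ-1-root x) all-roots)
        with 1≈0 ∷ [] ← ++⁻ʳ (replicate h' 0) ones
        with () ← <p∧≈0⇒≡0 (candidate<p (s≤s z≤n)) 1≈0
    ... | no ¬all-roots
        with i , i<1+h , aʰ≉1 ← Any.applyUpTo⁻ suc (¬All⇒Any¬ (λ a → a ^ h ≈? 1) candidates ¬all-roots)
        = suc i , Sum.[ ⊥-elim ∘ aʰ≉1 , id ]′ (square-≈⇒± (suc i ^ h) 1 aʰaʰ≈1)
      where
      a≉0 : ¬ suc i ≈ 0
      a≉0 a≈0 with () ← <p∧≈0⇒≡0 (candidate<p i<1+h) a≈0
      aʰaʰ≈1 : suc i ^ h * suc i ^ h ≈ 1 * 1
      aʰaʰ≈1 = begin
        suc i ^ h * suc i ^ h   ≡⟨ ^-distribˡ-+-* (suc i) h h ⟨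
        suc i ^ (h + h)         ≡⟨ cong (suc i ^_) q≡h+h ⟨
        suc i ^ q               ≈⟨ fermat a≉0 ⟩
        1                       ∎

  -1-is-power : ∀ h → 0 < h → q ≡ h + h → Σ ℕ λ a → a ^ h + 1 ≈ 0
  -1-is-power (suc h') _ = NonResidue.-1-is-power h'

  -- From y² ≈ (x²)^(2j) we get y ≈ ±x^(2j), and −x^(2j) ≈ x^(2(2^b + j)).
  root-of-unity⇒x²-power : ∀ b {x y} → x ^ 2 ^ b + 1 ≈ 0 → y ^ 2 ^ b ≈ 1 →
                           Σ ℕ λ j → j < 2 ^ b × y ≈ (x * x) ^ j
  root-of-unity⇒x²-power zero    {x} {y} _ y¹≈1 =
    0 , s≤s z≤n , ≈-trans (≈-reflexive (sym (*-identityʳ y))) y¹≈1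
  root-of-unity⇒x²-power (suc b) {x} {y} x^2^[1+b]+1≈0 y^2^[1+b]≈1
    with j , j<2^b , y²≈x⁴ʲ ← root-of-unity⇒x²-power b {x * x} {y * y}
           (≈-trans (≈-reflexive (cong (_+ 1) (sym (^-2^suc x b)))) x^2^[1+b]+1≈0)
           (≈-trans (≈-reflexive (sym (^-2^suc y b))) y^2^[1+b]≈1)
    with square-≈⇒± y ((x * x) ^ j) (≈-trans y²≈x⁴ʲ (≈-reflexive (^-distrib-* (x * x) (x * x) j)))
  ... | inj₁ y≈x²ʲ   = j , <-≤-trans j<2^b (m≤m+n (2 ^ b) _) , y≈x²ʲ
  ... | inj₂ y+x²ʲ≈0 = 2 ^ b + j , subst (2 ^ b + j <_) (sym (2^suc b)) (+-monoʳ-< (2 ^ b) j<2^b) ,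
    +-cancelʳ X (begin
      y + X                          ≈⟨ y+x²ʲ≈0 ⟩
      0                              ≡⟨ *-zeroˡ X ⟨
      0 * X                          ≈⟨ *-congʳ X x^2^[1+b]+1≈0 ⟨
      (x ^ 2 ^ suc b + 1) * X        ≡⟨ cong (λ z → (z + 1) * X) (^-2^suc x b) ⟩
      ((x * x) ^ 2 ^ b + 1) * X      ≡⟨ distrib ((x * x) ^ 2 ^ b) X ⟩
      (x * x) ^ 2 ^ b * X + X        ≡⟨ cong (_+ X) (^-distribˡ-+-* (x * x) (2 ^ b) j) ⟨
      (x * x) ^ (2 ^ b + j) + X      ∎)
    where
    X : ℕ
    X = (x * x) ^ j
    distrib : ∀ a X → (a + 1) * X ≡ a * X + X
    distrib = solve-∀

  geometric-sum≈0 : ∀ m {u} → u ^ m ≈ 1 → ¬ u ≈ 1 → ∑[ i < m ] (u ^ i) ≈ 0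
  geometric-sum≈0 m {u} uᵐ≈1 u≉1 = Sum.[ id , ⊥-elim ∘ u≉1 ]′ (*-cancelˡ S (begin
    S * u          ≡⟨ *-comm S u ⟩
    u * S          ≈⟨ +-cancelʳ 1 (begin
      u * S + 1      ≡⟨ geometric-sum m u ⟩
      u ^ m + S      ≈⟨ +-congʳ S uᵐ≈1 ⟩
      1 + S          ≡⟨ +-comm 1 S ⟩
      S + 1          ∎) ⟩
    S              ≡⟨ *-identityʳ S ⟨
    S * 1          ∎))
    where
    S : ℕ
    S = ∑[ i < m ] (u ^ i)

  module _ {w v m} (wv≈1 : w * v ≈ 1) (vᵐ≈1 : v ^ m ≈ 1)
           (w-order : ∀ d → 0 < d → d < m → ¬ w ^ d ≈ 1) where

    private
      vw≈1 : v * w ≈ 1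
      vw≈1 = ≈-trans (≈-reflexive (*-comm v w)) wv≈1

      wᵐ≈1 : w ^ m ≈ 1
      wᵐ≈1 = begin
        w ^ m            ≡⟨ *-identityʳ (w ^ m) ⟨
        w ^ m * 1        ≈⟨ *-congˡ (w ^ m) vᵐ≈1 ⟨
        w ^ m * v ^ m    ≈⟨ powers-inverse wv≈1 m ⟩
        1                ∎

      v-order : ∀ d → 0 < d → d < m → ¬ v ^ d ≈ 1
      v-order d 0<d d<m vᵈ≈1 = w-order d 0<d d<m (begin
        w ^ d            ≡⟨ *-identityʳ (w ^ d) ⟨
        w ^ d * 1        ≈⟨ *-congˡ (w ^ d) vᵈ≈1 ⟨
        w ^ d * v ^ d    ≈⟨ powers-inverse wv≈1 d ⟩
        1                ∎)

      vʲwʲ⁰≉1 : ∀ {j j₀} → j < m → j₀ < m → j ≢ j₀ → ¬ v ^ j * w ^ j₀ ≈ 1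
      vʲwʲ⁰≉1 {j} {j₀} j<m j₀<m j≢j₀ with <-cmp j j₀
      ... | tri< j<j₀ _ _ =
        w-order (j₀ ∸ j) (m<n⇒0<n∸m j<j₀) (≤-<-trans (m∸n≤m j₀ j) j₀<m) ∘ ≈-trans (begin
        w ^ (j₀ ∸ j)               ≈⟨ powers-cancel vw≈1 j (j₀ ∸ j) ⟨
        v ^ j * w ^ (j + (j₀ ∸ j)) ≡⟨ cong (λ e → v ^ j * w ^ e) (m+[n∸m]≡n (<⇒≤ j<j₀)) ⟩
        v ^ j * w ^ j₀             ∎)
      ... | tri≈ _ j≡j₀ _ = ⊥-elim (j≢j₀ j≡j₀)
      ... | tri> _ _ j>j₀ =
        v-order (j ∸ j₀) (m<n⇒0<n∸m j>j₀) (≤-<-trans (m∸n≤m j j₀) j<m) ∘ ≈-trans (begin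
        v ^ (j ∸ j₀)                ≈⟨ powers-cancel wv≈1 j₀ (j ∸ j₀) ⟨
        w ^ j₀ * v ^ (j₀ + (j ∸ j₀)) ≡⟨ cong (λ e → w ^ j₀ * v ^ e) (m+[n∸m]≡n (<⇒≤ j>j₀)) ⟩
        w ^ j₀ * v ^ j              ≡⟨ *-comm (w ^ j₀) (v ^ j) ⟩
        v ^ j * w ^ j₀              ∎)

    -- Orthogonality: Σ_t (v^j w^j₀)^t is m for j = j₀, and a vanishing geometric sum otherwise.
    fourier-inversion : ∀ (g : ℕ → ℕ) {y j₀} → j₀ < m → y ≈ w ^ j₀ →
      ∑[ t < m ] ((∑[ j < m ] (g j * (v ^ j) ^ t)) * y ^ t) ≈ m * g j₀
    fourier-inversion g {y} {j₀} j₀<m y≈wʲ⁰ = begin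
      ∑[ t < m ] ((∑[ j < m ] (g j * (v ^ j) ^ t)) * y ^ t)
        ≡⟨ ∑-cong m (λ t → *-distribʳ-∑ m (λ j → g j * (v ^ j) ^ t) (y ^ t)) ⟩
      ∑[ t < m ] ∑[ j < m ] (g j * (v ^ j) ^ t * y ^ t)
        ≡⟨ ∑-comm m m (λ t j → g j * (v ^ j) ^ t * y ^ t) ⟩
      ∑[ j < m ] ∑[ t < m ] (g j * (v ^ j) ^ t * y ^ t)
        ≡⟨ ∑-cong m regroup ⟩
      ∑[ j < m ] (g j * ∑[ t < m ] (u j ^ t))
        ≈⟨ ∑-single m (λ j → g j * ∑[ t < m ] (u j ^ t)) j₀<m off-diagonal ⟩
      g j₀ * ∑[ t < m ] (u j₀ ^ t)
        ≈⟨ *-congˡ (g j₀) (∑-cong≈ m (λ t → ^-congˡ t diagonal)) ⟩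
      g j₀ * ∑[ t < m ] (1 ^ t)
        ≡⟨ cong (g j₀ *_) (trans (∑-cong m ^-zeroˡ) (trans (∑-const m 1) (*-identityʳ m))) ⟩
      g j₀ * m
        ≡⟨ *-comm (g j₀) m ⟩
      m * g j₀
        ∎
      where
      u : ℕ → ℕ
      u j = v ^ j * y
      regroup : ∀ j → ∑[ t < m ] (g j * (v ^ j) ^ t * y ^ t) ≡ g j * ∑[ t < m ] (u j ^ t)
      regroup j = trans (∑-cong m λ t → trans (*-assoc (g j) _ _)
                                                (cong (g j *_) (sym (^-distrib-* (v ^ j) y t))))
                        (sym (*-distribˡ-∑ m (g j) (u j ^_)))
      uʲ≈vʲwʲ⁰ : ∀ j → u j ≈ v ^ j * w ^ j₀
      uʲ≈vʲwʲ⁰ j = *-congˡ (v ^ j) y≈wʲ⁰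
      diagonal : u j₀ ≈ 1
      diagonal = ≈-trans (uʲ≈vʲwʲ⁰ j₀) (powers-inverse vw≈1 j₀)
      uᵐ≈1 : ∀ j → u j ^ m ≈ 1
      uᵐ≈1 j = begin
        (v ^ j * y) ^ m           ≡⟨ ^-distrib-* (v ^ j) y m ⟩
        (v ^ j) ^ m * y ^ m       ≈⟨ *-congˡ ((v ^ j) ^ m) (^-congˡ m y≈wʲ⁰) ⟩
        (v ^ j) ^ m * (w ^ j₀) ^ m ≡⟨ cong₂ _*_ (^-^-comm v j m) (^-^-comm w j₀ m) ⟩
        (v ^ m) ^ j * (w ^ m) ^ j₀ ≈⟨ *-cong (^-congˡ j vᵐ≈1) (^-congˡ j₀ wᵐ≈1) ⟩
        1 ^ j * 1 ^ j₀            ≡⟨ cong₂ _*_ (^-zeroˡ j) (^-zeroˡ j₀) ⟩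
        1                         ∎
      off-diagonal : ∀ j → j < m → j ≢ j₀ → g j * ∑[ t < m ] (u j ^ t) ≈ 0
      off-diagonal j j<m j≢j₀ = begin
        g j * ∑[ t < m ] (u j ^ t)  ≈⟨ *-congˡ (g j) (geometric-sum≈0 m (uᵐ≈1 j)
                                        (vʲwʲ⁰≉1 j<m j₀<m j≢j₀ ∘ ≈-trans (≈-sym (uʲ≈vʲwʲ⁰ j)))) ⟩
        g j * 0                     ≡⟨ *-zeroʳ (g j) ⟩
        0                           ∎

-- The square-root polynomial

module SquareRoot (K r : ℕ) (prime : Prime (suc (2 ^ suc K * suc (r + r)))) where

  n m M h q : ℕ
  n = suc (r + r)
  m = 2 ^ K
  M = pred m
  h = m * n
  q = 2 ^ suc K * n

  open Modular q
  open PrimeField q prime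
  open ≈-Reasoning ≈-setoid

  m≡1+M : m ≡ suc M
  m≡1+M = sym (suc-pred m {{m^n≢0 2 K}})

  q≡h+h : q ≡ h + h
  q≡h+h = trans (cong (_* n) (2^suc K)) (*-distribʳ-+ n m m)

  2≤q : 2 ≤ q
  2≤q = ≤-trans (^-monoʳ-≤ 2 (s≤s (z≤n {K}))) (m≤m*n (2 ^ suc K) n)

  1≉0 : ¬ 1 ≈ 0
  1≉0 1≈0 with () ← <p∧≈0⇒≡0 (s≤s (≤-trans (s≤s z≤n) 2≤q)) 1≈0

  2≉0 : ¬ 2 ≈ 0
  2≉0 2≈0 with () ← <p∧≈0⇒≡0 (s≤s 2≤q) 2≈0

  nonresidue : Σ ℕ λ a → a ^ h + 1 ≈ 0
  nonresidue = -1-is-power h (≤-trans (m^n>0 2 K) (m≤m*n m n)) q≡h+h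

  ζ η w v : ℕ
  ζ = proj₁ nonresidue ^ n
  η = ζ ^ suc (M + M)    -- ζ⁻¹, since 2M + 1 = 2m − 1 and ζ^(2m) ≈ 1
  w = ζ * ζ
  v = η * η

  ζᵐ+1≈0 : ζ ^ m + 1 ≈ 0
  ζᵐ+1≈0 = begin
    (proj₁ nonresidue ^ n) ^ m + 1    ≡⟨ cong (_+ 1) (^-*-assoc (proj₁ nonresidue) n m) ⟩
    proj₁ nonresidue ^ (n * m) + 1    ≡⟨ cong (λ e → proj₁ nonresidue ^ e + 1) (*-comm n m) ⟩
    proj₁ nonresidue ^ h + 1          ≈⟨ proj₂ nonresidue ⟩
    0                                 ∎

  ηᵐ+1≈0 : η ^ m + 1 ≈ 0
  ηᵐ+1≈0 = ≈-trans (≈-reflexive (cong (_+ 1) (^-^-comm ζ (suc (M + M)) m))) (-1^odd M ζᵐ+1≈0)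

  ζη≈1 : ζ * η ≈ 1
  ζη≈1 = begin
    ζ ^ suc (suc (M + M))     ≡⟨ cong (λ e → ζ ^ suc e) (+-suc M M) ⟨
    ζ ^ (suc M + suc M)       ≡⟨ cong (λ e → ζ ^ (e + e)) m≡1+M ⟨
    ζ ^ (m + m)               ≡⟨ ^-distribˡ-+-* ζ m m ⟩
    ζ ^ m * ζ ^ m             ≈⟨ -1²≈1 ζᵐ+1≈0 ⟩
    1                         ∎

  wv≈1 : w * v ≈ 1
  wv≈1 = begin
    ζ * ζ * (η * η)       ≡⟨ [m*n]*[o*p]≡[m*o]*[n*p] ζ ζ η η ⟩
    ζ * η * (ζ * η)       ≈⟨ *-cong ζη≈1 ζη≈1 ⟩
    1                     ∎

  vᵐ≈1 : v ^ m ≈ 1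
  vᵐ≈1 = ≈-trans (≈-reflexive (^-distrib-* η η m)) (-1²≈1 ηᵐ+1≈0)

  w-order : ∀ d → 0 < d → d < m → ¬ w ^ d ≈ 1
  w-order = x²-order 2≉0 K ζᵐ+1≈0

  c : ℕ → ℕ
  c t = ∑[ j < m ] (η ^ j * (v ^ j) ^ t)

  c≉0 : ∀ t → ¬ c t ≈ 0
  c≉0 t = geometric-sum≉0 2≉0 m uᵐ+1≈0 ∘ ≈-trans (≈-sym (∑-cong≈ m c≈uʲ))
    where
    u : ℕ
    u = η ^ suc (t + t)
    uᵐ+1≈0 : u ^ m + 1 ≈ 0
    uᵐ+1≈0 = ≈-trans (≈-reflexive (cong (_+ 1) (^-^-comm η (suc (t + t)) m))) (-1^odd t ηᵐ+1≈0)
    c≈uʲ : ∀ j → η ^ j * (v ^ j) ^ t ≈ u ^ j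
    c≈uʲ j = begin
      η ^ j * (v ^ j) ^ t          ≡⟨ cong (η ^ j *_) (^-^-comm v j t) ⟩
      η ^ j * (v ^ t) ^ j          ≡⟨ cong (λ z → η ^ j * z ^ j) (^-square η t) ⟩
      η ^ j * (η ^ (t + t)) ^ j    ≡⟨ ^-distrib-* η (η ^ (t + t)) j ⟨
      u ^ j                        ∎

  c-interpolates : ∀ {y j₀} → j₀ < m → y ≈ w ^ j₀ → evalℕ (applyUpTo c m) y ≈ m * η ^ j₀
  c-interpolates {y} j₀<m y≈wʲ⁰ =
    ≈-trans (≈-reflexive (eval-applyUpTo m c y))
            (fourier-inversion wv≈1 vᵐ≈1 w-order (η ^_) j₀<m y≈wʲ⁰)

  s e : ℕ
  s = inv2 p ^ K
  e = (n + 1) / 2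

  e+e≡1+n : e + e ≡ suc n
  e+e≡1+n = trans (cong (λ z → z + z) ([1+2r+1]/2≡1+r r)) (cong suc (+-suc r r))

  sm≈1 : s * m ≈ 1
  sm≈1 = begin
    inv2 p ^ K * 2 ^ K     ≡⟨ ^-distrib-* (inv2 p) 2 K ⟨
    (inv2 p * 2) ^ K       ≈⟨ ^-congˡ K inv2p*2≈1 ⟩
    1 ^ K                  ≡⟨ ^-zeroˡ K ⟩
    1                      ∎
    where
    p+1≡[1+h]*2 : p + 1 ≡ suc h * 2
    p+1≡[1+h]*2 = trans (cong (λ z → suc z + 1) q≡h+h) (double h)
      where
      double : ∀ h → suc (h + h) + 1 ≡ suc h * 2
      double = solve-∀
    inv2p*2≈1 : inv2 p * 2 ≈ 1
    inv2p*2≈1 = begin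
      (p + 1) / 2 * 2      ≡⟨ cong (λ z → z / 2 * 2) p+1≡[1+h]*2 ⟩
      suc h * 2 / 2 * 2    ≡⟨ cong (_* 2) (m*n/n≡m (suc h) 2) ⟩
      suc h * 2            ≡⟨ p+1≡[1+h]*2 ⟨
      suc q + 1            ≡⟨ cong (_+ 1) (+-comm 1 q) ⟩
      q + 1 + 1            ≈⟨ +-congʳ 1 q+1≈0 ⟩
      1                    ∎

  s≉0 : ¬ s ≈ 0
  s≉0 s≈0 = 1≉0 (≈-trans (≈-sym sm≈1) (*-congʳ m s≈0))

  fcoeff : ℕ → ℕ
  fcoeff t = s * c t

  fcoeff≉0 : ∀ t → ¬ fcoeff t ≈ 0
  fcoeff≉0 t = Sum.[ s≉0 , c≉0 t ]′ ∘ *-≈0 s (c t)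

  fcoeff≢0 : ∀ t → fcoeff t mod p ≢ 0
  fcoeff≢0 t = fcoeff≉0 t ∘ ⟪_⟫

  coefficients : Vec ℕ m
  coefficients = Vec.cast (length-applyUpTo c m) (Vec.fromList (applyUpTo c m))

  toList-coefficients : toList coefficients ≡ applyUpTo c m
  toList-coefficients =
    trans (toList-cast _ (Vec.fromList (applyUpTo c m))) (toList∘fromList (applyUpTo c m))

  F : Poly
  F = fForm p (suc K) n coefficients

  eval-F : ∀ x → evalℕ F x ≡ s * (x ^ e * evalℕ (applyUpTo c m) (x ^ n))
  eval-F x = trans (eval-fForm p (suc K) n coefficients x)
                   (cong (λ z → s * (x ^ e * evalℕ z (x ^ n))) toList-coefficients)

  qr⇒root-of-unity : ∀ {x} → NonzeroQR p x → (x ^ n) ^ m ≈ 1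
  qr⇒root-of-unity {x} (x≢0 , y₀ , y₀²≡x) = begin
    (x ^ n) ^ m          ≡⟨ ^-*-assoc x n m ⟩
    x ^ (n * m)          ≡⟨ cong (x ^_) (*-comm n m) ⟩
    x ^ h                ≈⟨ ^-congˡ h y₀²≈x ⟨
    (y₀ * y₀) ^ h        ≡⟨ ^-square y₀ h ⟩
    y₀ ^ (h + h)         ≡⟨ cong (y₀ ^_) q≡h+h ⟨
    y₀ ^ q               ≈⟨ fermat y₀≉0 ⟩
    1                    ∎
    where
    y₀²≈x : y₀ * y₀ ≈ x
    y₀²≈x = ⟪ y₀²≡x ⟫
    y₀≉0 : ¬ y₀ ≈ 0
    y₀≉0 y₀≈0 = x≢0 (residue-≡ (≈-trans (≈-sym y₀²≈x) (*-congʳ y₀ y₀≈0)))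

  F-square : ∀ x {j₀} → j₀ < m → x ^ n ≈ w ^ j₀ → evalℕ F x * evalℕ F x ≈ x
  F-square x {j₀} j₀<m xⁿ≈wʲ⁰ = begin
    evalℕ F x * evalℕ F x                      ≡⟨ cong₂ _*_ (eval-F x) (eval-F x) ⟩
    s * (X * G) * (s * (X * G))                ≈⟨ *-cong sXG≈sXmH sXG≈sXmH ⟩
    s * (X * (m * H)) * (s * (X * (m * H)))    ≡⟨ rearrange s X m H ⟩
    s * m * (s * m) * (X * X * (H * H))        ≈⟨ *-congʳ (X * X * (H * H)) (*-cong sm≈1 sm≈1) ⟩
    1 * (X * X * (H * H))                      ≡⟨ *-identityˡ (X * X * (H * H)) ⟩
    X * X * (H * H)                            ≡⟨ cong₂ _*_ X²≡x*xⁿ (sym (^-distrib-* η η j₀)) ⟩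
    x * x ^ n * v ^ j₀                         ≈⟨ *-congʳ (v ^ j₀) (*-congˡ x xⁿ≈wʲ⁰) ⟩
    x * w ^ j₀ * v ^ j₀                        ≡⟨ *-assoc x (w ^ j₀) (v ^ j₀) ⟩
    x * (w ^ j₀ * v ^ j₀)                      ≈⟨ *-congˡ x (powers-inverse wv≈1 j₀) ⟩
    x * 1                                      ≡⟨ *-identityʳ x ⟩
    x                                          ∎
    where
    X G H : ℕ
    X = x ^ e
    G = evalℕ (applyUpTo c m) (x ^ n)
    H = η ^ j₀
    sXG≈sXmH : s * (X * G) ≈ s * (X * (m * H))
    sXG≈sXmH = *-congˡ s (*-congˡ X (c-interpolates j₀<m xⁿ≈wʲ⁰))
    X²≡x*xⁿ : X * X ≡ x * x ^ n
    X²≡x*xⁿ = trans (sym (^-distribˡ-+-* x e e)) (cong (x ^_) e+e≡1+n)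
    rearrange : ∀ s X m H →
                s * (X * (m * H)) * (s * (X * (m * H))) ≡ s * m * (s * m) * (X * X * (H * H))
    rearrange = solve-∀

  F-sqrt : SqrtRep p F
  F-sqrt x qr
    with j₀ , j₀<m , xⁿ≈wʲ⁰ ← root-of-unity⇒x²-power K ζᵐ+1≈0 (qr⇒root-of-unity {x} qr)
    = residue-≡ (F-square x j₀<m xⁿ≈wʲ⁰)

  F≡ : F ≡ shift e (seriesIn n (applyUpTo fcoeff m))
  F≡ = trans (fForm≡shift-seriesIn p (suc K) (r + r) coefficients)
             (cong (λ z → shift e (seriesIn n z))
                   (trans (cong (map (s *_)) toList-coefficients) (map-applyUpTo c (s *_) m)))

  F-degree : HasDegree p F (m * n ∸ (n ∸ 1) / 2)
  F-degree = subst₂ (HasDegree p) F′≡F degree≡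
    (degree-shift p e (degree-seriesIn p (r + r) (applyUpTo fcoeff M) (fcoeff≢0 M)))
    where
    F′≡F : shift e (seriesIn n (applyUpTo fcoeff M ++ fcoeff M ∷ [])) ≡ F
    F′≡F = trans (cong (λ z → shift e (seriesIn n z))
                       (trans (applyUpTo-∷ʳ fcoeff M) (cong (applyUpTo fcoeff) (sym m≡1+M))))
                 (sym F≡)
    degree≡ : e + length (applyUpTo fcoeff M) * n ≡ m * n ∸ (n ∸ 1) / 2
    degree≡ = trans (cong (λ l → e + l * n) (length-applyUpTo fcoeff M))
                    (trans ([n+1]/2+M*n≡[1+M]*n∸[n∸1]/2 M r)
                           (cong (λ k → k * n ∸ (n ∸ 1) / 2) (sym m≡1+M)))

  F-terms : terms p F ≡ m
  F-terms = trans (cong (terms p) F≡)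
    (trans (terms-shift p e (seriesIn n (applyUpTo fcoeff m)))
      (trans (terms-seriesIn p (r + r) (applyUpTo fcoeff m) (applyUpTo⁺₂ fcoeff m fcoeff≢0))
             (length-applyUpTo fcoeff m)))

  square-root-polynomial : Σ (Vec ℕ m) λ c →
    SqrtRep p (fForm p (suc K) n c) × HasDegree p (fForm p (suc K) n c) (m * n ∸ (n ∸ 1) / 2) ×
    terms p (fForm p (suc K) n c) ≡ m
  square-root-polynomial = coefficients , F-sqrt , F-degree , F-terms

theorem6 : (k n p : ℕ) → 1 ≤ k → n % 2 ≡ 1 → p ≡ 2 ^ k * n + 1 → Prime p →
    Σ (Vec ℕ (2 ^ (k ∸ 1))) (λ c →
      SqrtRep p (fForm p k n c)
      × HasDegree p (fForm p k n c) (2 ^ (k ∸ 1) * n ∸ (n ∸ 1) / 2)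
      × terms p (fForm p k n c) ≡ 2 ^ (k ∸ 1))
theorem6 (suc K) n p (s≤s z≤n) n-odd p≡2ᵏn+1 p-prime
  with r , refl ← odd⇒≡1+2r {n} n-odd
  with refl ← trans p≡2ᵏn+1 (+-comm (2 ^ suc K * suc (r + r)) 1)
  = SquareRoot.square-root-polynomial K r p-prime
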